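{- Let $d\ge2$, let $F(X)=X^d+a_1X^{d-1}+\cdots+a_d\in\mathbb{Z}[X]$ be monic and irreducible, and let $\alpha$ be a root of $F$. Let $m,n$ be positive integers and $\mu,\nu$ integers with $F(\mu)\equiv0\pmod m$ and $F(\nu)\equiv0\pmod n$. Let $I$ be the ideal of $\mathbb{Z}[\alpha]$ with $\mathbb{Z}$-basis $\{\alpha^{d-1}-\mu^{d-1},\dots,\alpha-\mu,m\}$ and $J$ the ideal with $\mathbb{Z}$-basis $\{\alpha^{d-1}-\nu^{d-1},\dots,\alpha-\nu,n\}$. Then $m\equiv0\pmod n$ and $\mu\equiv\nu\pmod n$ if and only if $I\subseteq J$. -}

module Defs where

open import Data.Nat using (ℕ; zero; suc)
open import Data.Integer using (ℤ; _+_; _*_; -_; _^_; 0ℤ; 1ℤ; -1ℤ)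
open import Data.Fin using (Fin; zero; suc; opposite)
import Data.Fin as Fin
open import Data.List using (List; []; _∷_; [_]; _++_; map; tabulate)
open import Data.Sum using (_⊎_)
open import Data.Product using (_×_; ∃)
open import Relation.Nullary using (¬_; does)
open import Relation.Binary.PropositionalEquality using (_≡_)
open import Data.Bool using (if_then_else_)

-- Polynomials over ℤ as coefficient lists, lowest degree first.

Poly : Set
Poly = List ℤ

coeff : Poly → ℕ → ℤ
coeff []      k       = 0ℤ
coeff (c ∷ p) zero    = c
coeff (c ∷ p) (suc k) = coeff p k

-- equality of polynomials (trailing zeros ignored)
_≈P_ : Poly → Poly → Set
p ≈P q = ∀ k → coeff p k ≡ coeff q k

_+P_ : Poly → Poly → Poly
[]      +P q       = q
(a ∷ p) +P []      = a ∷ p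
(a ∷ p) +P (b ∷ q) = (a + b) ∷ (p +P q)

_*P_ : Poly → Poly → Poly
[]      *P q = []
(c ∷ p) *P q = map (c *_) q +P (0ℤ ∷ (p *P q))

evalP : Poly → ℤ → ℤ
evalP []      x = 0ℤ
evalP (c ∷ p) x = c + x * evalP p x

IsUnitP : Poly → Set
IsUnitP p = (p ≈P [ 1ℤ ]) ⊎ (p ≈P [ -1ℤ ])

IrreducibleP : Poly → Set
IrreducibleP p = ¬ (p ≈P []) × ¬ IsUnitP p
               × (∀ g h → p ≈P (g *P h) → IsUnitP g ⊎ IsUnitP h)

-- F(X) = X^d + a₁X^{d-1} + ... + a_d, where a i = a_{i+1} (i : Fin d).
-- Coefficient of X^j (j < d) is a_{d-j} = a (opposite j).
monicPoly : (d : ℕ) → (Fin d → ℤ) → Poly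
monicPoly d a = tabulate (λ j → a (opposite j)) ++ [ 1ℤ ]

-- ℤ[α] ≅ ℤ^d via the ℤ-basis 1, α, ..., α^{d-1} (α root of the monic
-- irreducible F of degree d). An element is its coordinate vector.

Zα : ℕ → Set
Zα d = Fin d → ℤ

sumFin : ∀ {n} → (Fin n → ℤ) → ℤ
sumFin {zero}  f = 0ℤ
sumFin {suc n} f = f zero + sumFin (λ i → f (suc i))

-- gen μ m k : the k-th ℤ-basis element of the ideal
--   k = 0      : m
--   k ≥ 1      : α^k - μ^k
gen : ∀ {d} → ℤ → ℤ → Fin d → Zα d
gen μ m zero    zero    = m
gen μ m zero    (suc j) = 0ℤ
gen μ m (suc k) zero    = - (μ ^ suc (Fin.toℕ k))
gen μ m (suc k) (suc j) = if does (k Fin.≟ j) then 1ℤ else 0ℤ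

InIdeal : ∀ {d} → ℤ → ℤ → Zα d → Set
InIdeal {d} μ m x = ∃ λ (c : Fin d → ℤ) → ∀ j → x j ≡ sumFin (λ k → c k * gen μ m k j)

_⊆I_ : ∀ {d} → (Zα d → Set) → (Zα d → Set) → Set
_⊆I_ {d} I J = ∀ (x : Zα d) → I x → J x

{-# OPTIONS --safe #-}
-- Write x ∈ ℤ[α] as x(α) with x ∈ ℤ[X] of degree < d.  The generators α^k − μ^k
-- (k ≥ 1) are unitriangular in the coordinates x₁, …, x_{d−1}, so x lies in the
-- ℤ-span I of them and m exactly when m ∣ x(μ).  As x(μ) ≡ x(ν) (mod n) when
-- μ ≡ ν (mod n), the two conditions give I ⊆ J; conversely the elements m and
-- α − μ of I (here d ≥ 2 is needed) lying in J give n ∣ m and n ∣ ν − μ.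
module Submission where

open import Defs
open import Data.Nat using (ℕ; _≤_; zero; suc; s≤s)
open import Data.Fin using (Fin; toℕ; zero; suc; _≟_)
open import Data.Integer using (ℤ; _-_; 0ℤ; 1ℤ; _<_; _+_; _*_; -_; _^_)
open import Data.Integer.Divisibility using (_∣_)
import Data.Integer.Divisibility.Signed as Signed
open Signed using (divides; ∣ᵤ⇒∣; ∣⇒∣ᵤ; ∣-refl; ∣-trans; ∣m∣n⇒∣m+n; ∣m∣n⇒∣m-n; ∣m⇒∣-m; ∣n⇒∣m*n; ∣m⇒∣m*n)
open import Data.Integer.Properties using (*-assoc; *-zeroʳ; *-identityʳ; +-identityˡ; +-identityʳ; +-inverseʳ; neg-distribˡ-*)
open import Data.Integer.Solver using (module +-*-Solver)
open import Data.Product using (_×_; _,_)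
open import Data.List using (tabulate)
open import Data.Bool using (if_then_else_)
open import Function.Base using (_∘_)
open import Function.Bundles using (_⇔_; mk⇔; Equivalence)
open import Relation.Nullary using (does)
open import Relation.Binary.PropositionalEquality using (_≡_; refl; sym; trans; cong; cong₂; subst; module ≡-Reasoning)
open +-*-Solver using (solve; con; _:+_; _:-_; _:*_; :-_; _:=_)

sumFin-cong : ∀ {n} {f g : Fin n → ℤ} → (∀ k → f k ≡ g k) → sumFin f ≡ sumFin g
sumFin-cong {zero}  f≡g = refl
sumFin-cong {suc n} f≡g = cong₂ _+_ (f≡g zero) (sumFin-cong (λ k → f≡g (suc k)))

sumFin-zero : ∀ {n} {f : Fin n → ℤ} → (∀ k → f k ≡ 0ℤ) → sumFin f ≡ 0ℤ
sumFin-zero {zero}  f≡0 = refl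
sumFin-zero {suc n} f≡0 = cong₂ _+_ (f≡0 zero) (sumFin-zero (λ k → f≡0 (suc k)))

indicator : ∀ {n} → Fin n → Fin n → ℤ
indicator k j = if does (k ≟ j) then 1ℤ else 0ℤ

sumFin-*-indicator : ∀ {n} (f : Fin n → ℤ) j → sumFin (λ k → f k * indicator k j) ≡ f j
sumFin-*-indicator f zero = begin
  f zero * 1ℤ + sumFin (λ k → f (suc k) * 0ℤ)
    ≡⟨ cong₂ _+_ (*-identityʳ (f zero)) (sumFin-zero (λ k → *-zeroʳ (f (suc k)))) ⟩
  f zero + 0ℤ
    ≡⟨ +-identityʳ (f zero) ⟩
  f zero ∎
  where open ≡-Reasoning
sumFin-*-indicator f (suc j) = begin
  f zero * 0ℤ + sumFin (λ k → f (suc k) * indicator k j)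
    ≡⟨ cong₂ _+_ (*-zeroʳ (f zero)) (sumFin-*-indicator (λ k → f (suc k)) j) ⟩
  0ℤ + f (suc j)
    ≡⟨ +-identityˡ (f (suc j)) ⟩
  f (suc j) ∎
  where open ≡-Reasoning

tail : ∀ {d} → Zα (suc d) → Zα d
tail x k = x (suc k)

evalZα : ∀ {d} → ℤ → Zα d → ℤ
evalZα t x = evalP (tabulate x) t

evalZα-cong : ∀ {d} t {x y : Zα d} → (∀ j → x j ≡ y j) → evalZα t x ≡ evalZα t y
evalZα-cong {zero}  t x≡y = refl
evalZα-cong {suc d} t x≡y = cong₂ (λ a b → a + t * b) (x≡y zero) (evalZα-cong t (λ j → x≡y (suc j)))

evalZα-zero : ∀ {d} t → evalZα {d} t (λ _ → 0ℤ) ≡ 0ℤ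
evalZα-zero {zero}  t = refl
evalZα-zero {suc d} t = begin
  0ℤ + t * evalZα {d} t (λ _ → 0ℤ) ≡⟨ cong (λ e → 0ℤ + t * e) (evalZα-zero {d} t) ⟩
  0ℤ + t * 0ℤ                       ≡⟨ cong (0ℤ +_) (*-zeroʳ t) ⟩
  0ℤ                                ∎
  where open ≡-Reasoning

sumFin-*-powers : ∀ {d} s t (x : Zα d) → sumFin (λ k → x k * (s * t ^ toℕ k)) ≡ s * evalZα t x
sumFin-*-powers {zero}  s t x = sym (*-zeroʳ s)
sumFin-*-powers {suc d} s t x = begin
  x zero * (s * 1ℤ) + sumFin (λ k → x (suc k) * (s * (t * t ^ toℕ k)))
    ≡⟨ cong (x zero * (s * 1ℤ) +_) (sumFin-cong (λ k → cong (x (suc k) *_) (sym (*-assoc s t (t ^ toℕ k))))) ⟩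
  x zero * (s * 1ℤ) + sumFin (λ k → x (suc k) * (s * t * t ^ toℕ k))
    ≡⟨ cong (x zero * (s * 1ℤ) +_) (sumFin-*-powers (s * t) t (tail x)) ⟩
  x zero * (s * 1ℤ) + s * t * evalZα t (tail x)
    ≡⟨ solve 4 (λ a s t e → a :* (s :* con 1ℤ) :+ s :* t :* e := s :* (a :+ t :* e))
               refl (x zero) s t (evalZα t (tail x)) ⟩
  s * evalZα t x ∎
  where open ≡-Reasoning

∣μ-ν⇒∣evalZα-difference : ∀ {d n} μ ν (x : Zα d) →
                           n Signed.∣ μ - ν → n Signed.∣ evalZα μ x - evalZα ν x
∣μ-ν⇒∣evalZα-difference {zero}  μ ν x n∣μ-ν = divides 0ℤ refl
∣μ-ν⇒∣evalZα-difference {suc d} {n} μ ν x n∣μ-ν =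
  subst (n Signed.∣_) (sym horner)
    (∣m∣n⇒∣m+n (∣n⇒∣m*n μ (∣μ-ν⇒∣evalZα-difference μ ν (tail x) n∣μ-ν))
               (∣m⇒∣m*n (evalZα ν (tail x)) n∣μ-ν))
  where
  horner : evalZα μ x - evalZα ν x
         ≡ μ * (evalZα μ (tail x) - evalZα ν (tail x)) + (μ - ν) * evalZα ν (tail x)
  horner = solve 5 (λ a μ ν e f → (a :+ μ :* e) :- (a :+ ν :* f) := μ :* (e :- f) :+ (μ :- ν) :* f)
             refl (x zero) μ ν (evalZα μ (tail x)) (evalZα ν (tail x))

combination : ∀ {d} → ℤ → ℤ → (Fin d → ℤ) → Zα d
combination μ m c j = sumFin (λ k → c k * gen μ m k j)

combination-zero : ∀ {d} μ m (c : Fin (suc d) → ℤ) →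
                   combination μ m c zero ≡ c zero * m - μ * evalZα μ (tail c)
combination-zero μ m c = begin
  c zero * m + sumFin (λ k → c (suc k) * - (μ * μ ^ toℕ k))
    ≡⟨ cong (c zero * m +_) (sumFin-cong (λ k → cong (c (suc k) *_) (neg-distribˡ-* μ (μ ^ toℕ k)))) ⟩
  c zero * m + sumFin (λ k → c (suc k) * (- μ * μ ^ toℕ k))
    ≡⟨ cong (c zero * m +_) (sumFin-*-powers (- μ) μ (tail c)) ⟩
  c zero * m + - μ * evalZα μ (tail c)
    ≡⟨ cong (c zero * m +_) (neg-distribˡ-* μ (evalZα μ (tail c))) ⟨
  c zero * m - μ * evalZα μ (tail c) ∎
  where open ≡-Reasoning

combination-suc : ∀ {d} μ m (c : Fin (suc d) → ℤ) j → combination μ m c (suc j) ≡ c (suc j)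
combination-suc μ m c j = begin
  c zero * 0ℤ + sumFin (λ k → c (suc k) * indicator k j)
    ≡⟨ cong₂ _+_ (*-zeroʳ (c zero)) (sumFin-*-indicator (tail c) j) ⟩
  0ℤ + c (suc j)
    ≡⟨ +-identityˡ (c (suc j)) ⟩
  c (suc j) ∎
  where open ≡-Reasoning

InIdeal⇔∣evalZα : ∀ {d} μ m (x : Zα d) → InIdeal μ m x ⇔ m Signed.∣ evalZα μ x
InIdeal⇔∣evalZα {zero}  μ m x = mk⇔ (λ _ → divides 0ℤ refl) (λ _ → (λ ()) , λ ())
InIdeal⇔∣evalZα {suc d} μ m x = mk⇔ to from
  where
  open ≡-Reasoning
  to : InIdeal μ m x → m Signed.∣ evalZα μ x
  to (c , x≡c) = divides (c zero) (begin
    x zero + μ * evalZα μ (tail x)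
      ≡⟨ cong₂ (λ a e → a + μ * e) (trans (x≡c zero) (combination-zero μ m c))
                                   (evalZα-cong μ (λ j → trans (x≡c (suc j)) (combination-suc μ m c j))) ⟩
    (c zero * m - μ * evalZα μ (tail c)) + μ * evalZα μ (tail c)
      ≡⟨ solve 2 (λ a b → (a :- b) :+ b := a) refl (c zero * m) (μ * evalZα μ (tail c)) ⟩
    c zero * m ∎)
  from : m Signed.∣ evalZα μ x → InIdeal μ m x
  from (divides q evalZα≡q*m) = c , x≡c
    where
    c : Fin (suc d) → ℤ
    c zero    = q
    c (suc k) = x (suc k)
    x≡c : ∀ j → x j ≡ combination μ m c j
    x≡c zero = begin
      x zero
        ≡⟨ solve 2 (λ a b → a := (a :+ b) :- b) refl (x zero) (μ * evalZα μ (tail x)) ⟩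
      (x zero + μ * evalZα μ (tail x)) - μ * evalZα μ (tail x)
        ≡⟨ cong (_- μ * evalZα μ (tail x)) evalZα≡q*m ⟩
      q * m - μ * evalZα μ (tail x)
        ≡⟨ combination-zero μ m c ⟨
      combination μ m c zero ∎
    x≡c (suc j) = sym (combination-suc μ m c j)

evalZα-gen-zero : ∀ {d} t μ m → evalZα {suc d} t (gen μ m zero) ≡ m
evalZα-gen-zero {d} t μ m = begin
  m + t * evalZα {d} t (λ _ → 0ℤ) ≡⟨ cong (λ e → m + t * e) (evalZα-zero {d} t) ⟩
  m + t * 0ℤ                      ≡⟨ cong (m +_) (*-zeroʳ t) ⟩
  m + 0ℤ                          ≡⟨ +-identityʳ m ⟩
  m                               ∎
  where open ≡-Reasoning

evalZα-gen-one : ∀ {d} t μ m → evalZα {suc (suc d)} t (gen μ m (suc zero)) ≡ t - μ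
evalZα-gen-one {d} t μ m = begin
  - (μ * 1ℤ) + t * (1ℤ + t * evalZα {d} t (λ _ → 0ℤ))
    ≡⟨ cong (λ e → - (μ * 1ℤ) + t * (1ℤ + t * e)) (evalZα-zero {d} t) ⟩
  - (μ * 1ℤ) + t * (1ℤ + t * 0ℤ)
    ≡⟨ solve 2 (λ t μ → :- (μ :* con 1ℤ) :+ t :* (con 1ℤ :+ t :* con 0ℤ) := t :- μ) refl t μ ⟩
  t - μ ∎
  where open ≡-Reasoning

lemma5 : (d : ℕ) → 2 ≤ d → (a : Fin d → ℤ) → IrreducibleP (monicPoly d a)
         → (m n μ ν : ℤ) → 0ℤ < m → 0ℤ < n
         → m ∣ evalP (monicPoly d a) μ → n ∣ evalP (monicPoly d a) ν
         → ((n ∣ m) × (n ∣ (μ - ν))) ⇔ (InIdeal {d} μ m ⊆I InIdeal {d} ν n)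
lemma5 .(suc (suc d)) (s≤s (s≤s {n = d} _)) _ _ m n μ ν _ _ _ _ = mk⇔ sufficient necessary
  where
  I⇔ : ∀ (x : Zα (suc (suc d))) → InIdeal μ m x ⇔ m Signed.∣ evalZα μ x
  I⇔ = InIdeal⇔∣evalZα μ m
  J⇔ : ∀ (x : Zα (suc (suc d))) → InIdeal ν n x ⇔ n Signed.∣ evalZα ν x
  J⇔ = InIdeal⇔∣evalZα ν n

  sufficient : (n ∣ m) × (n ∣ (μ - ν)) → InIdeal μ m ⊆I InIdeal ν n
  sufficient (n∣m , n∣μ-ν) x x∈I = Equivalence.from (J⇔ x)
    (subst (n Signed.∣_) (solve 2 (λ a b → a :- (a :- b) := b) refl (evalZα μ x) (evalZα ν x))
      (∣m∣n⇒∣m-n (∣-trans (∣ᵤ⇒∣ n∣m) (Equivalence.to (I⇔ x) x∈I))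
                 (∣μ-ν⇒∣evalZα-difference μ ν x (∣ᵤ⇒∣ n∣μ-ν))))

  necessary : InIdeal μ m ⊆I InIdeal ν n → (n ∣ m) × (n ∣ (μ - ν))
  necessary I⊆J = ∣⇒∣ᵤ n∣m , ∣⇒∣ᵤ n∣μ-ν
    where
    transfer : ∀ x → m Signed.∣ evalZα μ x → n Signed.∣ evalZα ν x
    transfer x = Equivalence.to (J⇔ x) ∘ I⊆J x ∘ Equivalence.from (I⇔ x)
    n∣m : n Signed.∣ m
    n∣m = subst (n Signed.∣_) (evalZα-gen-zero {suc d} ν μ m)
            (transfer (gen μ m zero) (subst (m Signed.∣_) (sym (evalZα-gen-zero {suc d} μ μ m)) ∣-refl))
    n∣ν-μ : n Signed.∣ ν - μ
    n∣ν-μ = subst (n Signed.∣_) (evalZα-gen-one {d} ν μ m)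
              (transfer (gen μ m (suc zero)) (divides 0ℤ (trans (evalZα-gen-one {d} μ μ m) (+-inverseʳ μ))))
    n∣μ-ν : n Signed.∣ μ - ν
    n∣μ-ν = subst (n Signed.∣_) (solve 2 (λ μ ν → :- (ν :- μ) := μ :- ν) refl μ ν) (∣m⇒∣-m n∣ν-μ)
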